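{- For every $n\ge1$, the number of boolean intervals in the middle order $\mathcal{P}_n$ is $(2n-1)!!=1\cdot3\cdot5\cdots(2n-1)$.
   Context: For $w\in S_n$ (one-line notation), its inversion sequence is $I(w)=(x_1,\ldots,x_n)$ with $x_i=\#\{j<i : w^{ -1}(j)>w^{ -1}(i)\}$. The middle order $\mathcal{P}_n$ is the poset on $S_n$ with $v\le w$ iff $I(v)\le I(w)$ coordinate-wise. An interval $[v,w]$ ($v\le w$) is boolean if it is isomorphic to a boolean algebra (the lattice of subsets of a finite set); this includes one-element intervals. -}

module Defs where

open import Data.Nat using (ℕ; zero; suc; _+_; _*_; _≤_; _<?_)
open import Data.Fin using (Fin; toℕ; _≟_)
open import Data.Fin.Subset using (Subset; _⊆_)
open import Data.Vec using (Vec; lookup)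
open import Data.List using (List; length; filter; cartesianProduct; allFin)
open import Data.Product using (Σ; _×_; _,_; proj₁)
open import Relation.Nullary.Decidable using (_×-dec_)
open import Relation.Binary.PropositionalEquality using (_≡_)
open import Function.Bundles using (_⇔_)

-- A permutation of {0,…,n-1} in one-line notation: an injective word
-- (injective endomaps of a finite set are bijections).
IsPerm : ∀ {n} → Vec (Fin n) n → Set
IsPerm {n} w = ∀ (i j : Fin n) → lookup w i ≡ lookup w j → i ≡ j

-- Inversion sequence (0-based): x_i = #{ j < i : w⁻¹(j) > w⁻¹(i) }.
-- Written without the inverse: x_i counts pairs of positions (q , p) with
-- q < p, w(q) = i and w(p) < i  (then j = w(p), w⁻¹(i) = q, w⁻¹(j) = p).
invSeq : ∀ {n} → Vec (Fin n) n → Fin n → ℕ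
invSeq {n} w i = length (filter P (cartesianProduct (allFin n) (allFin n)))
  where
  P = λ (qp : Fin n × Fin n) →
        let q = proj₁ qp ; p = Data.Product.proj₂ qp in
        (toℕ q <? toℕ p) ×-dec ((lookup w q ≟ i) ×-dec (toℕ (lookup w p) <? toℕ i))

_≼_ : ∀ {n} → Vec (Fin n) n → Vec (Fin n) n → Set
_≼_ {n} v w = ∀ (i : Fin n) → invSeq v i ≤ invSeq w i

Elem : ∀ {n} → Vec (Fin n) n → Vec (Fin n) n → Set
Elem {n} v w = Σ (Vec (Fin n) n) λ u → IsPerm u × (v ≼ u) × (u ≼ w)

IsBoolean : ∀ {n} → Vec (Fin n) n → Vec (Fin n) n → Set
IsBoolean v w =
  Σ ℕ λ k →
  Σ (Elem v w → Subset k) λ f →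
  Σ (Subset k → Elem v w) λ g →
    (∀ e → proj₁ (g (f e)) ≡ proj₁ e) ×
    (∀ s → f (g s) ≡ s) ×
    (∀ e e′ → (proj₁ e ≼ proj₁ e′) ⇔ (f e ⊆ f e′))

BooleanInterval : ∀ {n} → Vec (Fin n) n → Vec (Fin n) n → Set
BooleanInterval v w = IsPerm v × IsPerm w × (v ≼ w) × IsBoolean v w

-- (2n-1)!! = 1·3·5···(2n-1)   (with (−1)!! = 1 for n = 0)
oddFact : ℕ → ℕ
oddFact zero = 1
oddFact (suc n) = suc (n + n) * oddFact n

-- Inserting the maximum n into a permutation of {0, …, n-1} at position p leaves the inversion
-- counts of the old values unchanged and gives the new value the count n - p. By induction the
-- inversion sequence is a bijection from permutations onto the sequences c with c i ≤ i, so the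
-- middle order is a product of chains and the interval [v , w] is the box ∏ᵢ [I(v)ᵢ , I(w)ᵢ].
-- If every side has length at most 1, the box is the lattice of subsets of the coordinates where
-- I(w) exceeds I(v). If I(w)ᵢ ≥ I(v)ᵢ + 2, raising I(v) by 1 and by 2 at i gives v < m < t with
-- every element of [v , t] comparable to m, whereas in a subset lattice any A ⊂ M ⊂ T admits an
-- S ∈ [A , T] incomparable to M. Boolean intervals thus amount to choosing, for each i, a pair
-- (x , y) with y ∈ {x , x + 1} and y ≤ i, which can be done in 2i + 1 ways.

module Submission where

open import Defs
open import Data.Nat using (ℕ; _≤_)
open import Data.Fin using (Fin)
open import Data.Vec using (Vec)
open import Data.List using (List; length)
open import Data.List.Membership.Propositional using (_∈_)
open import Data.List.Relation.Unary.Unique.Propositional using (Unique)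
open import Data.Product using (Σ; _×_; _,_)
open import Relation.Binary.PropositionalEquality using (_≡_)
open import Function.Bundles using (_⇔_)

open import Data.Nat using (zero; suc; _+_; _*_; _∸_; _<_; _<?_; _≤?_; z≤n; s≤s; s≤s⁻¹)
import Data.Nat.Properties as ℕₚ
open import Data.Fin as Fin using (toℕ; fromℕ; fromℕ<; inject₁; punchIn; punchOut; lower₁; _≟_)
import Data.Fin.Properties as Finₚ
open import Data.Fin.Subset using (Subset; Side; inside; outside; ∣_∣; _⊆_; _∪_; ⁅_⁆)
  renaming (_∈_ to _∈ₛ_; _∉_ to _∉ₛ_)
import Data.Fin.Subset.Properties as Subsetₚ
open import Data.Vec using ([]; _∷_; here; there; _∷ʳ_; initLast; lookup; tabulate)
import Data.Vec.Properties as Vecₚ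
open import Data.Vec.Functional using (updateAt)
import Data.Vec.Functional.Properties as Vectorₚ
import Data.List as List
open import Data.List using (filter; cartesianProduct; cartesianProductWith; _++_; map; upTo)
import Data.List.Properties as Listₚ
import Data.List.Membership.Propositional.Properties as ∈ₚ
open import Data.List.Relation.Unary.Any using (here)
import Data.List.Relation.Unary.All as All
import Data.List.Relation.Unary.AllPairs as AllPairs
import Data.List.Relation.Unary.Unique.Propositional.Properties as Uniqueₚ
open import Data.Bool using (true)
open import Data.Empty using (⊥)
open import Data.Product using (∃; proj₁; proj₂)
open import Data.Product.Function.NonDependent.Propositional using (_×-⇔_)
open import Data.Sum using (_⊎_; inj₁; inj₂; [_,_]′)
open import Function using (_∘_; id)
open import Function.Bundles using (mk⇔; module Equivalence)
open Equivalence using (to; from)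
open import Function.Definitions using (Injective)
import Function.Properties.Equivalence as ⇔
open import Relation.Nullary using (Dec; yes; no; ¬_; does; contradiction)
open import Relation.Nullary.Decidable using (_×-dec_; _→-dec_)
open import Relation.Unary using (Pred; Decidable)
open import Relation.Binary.PropositionalEquality
  using (refl; sym; trans; cong; cong₂; subst; subst₂; _≢_; _≗_; module ≡-Reasoning)
open import Algebra.Properties.CommutativeMonoid.Sum ℕₚ.+-0-commutativeMonoid
  using (sum; sum-remove; sum-cong-≗; sum-replicate-zero)

private variable
  m n : ℕ

ind : ∀ {p} {P : Set p} → Dec P → ℕ
ind (yes _) = 1
ind (no _) = 0

ind-yes : ∀ {p} {P : Set p} (d : Dec P) → P → ind d ≡ 1
ind-yes (yes _) _ = refl
ind-yes (no ¬p) p = contradiction p ¬p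

ind-no : ∀ {p} {P : Set p} (d : Dec P) → ¬ P → ind d ≡ 0
ind-no (yes p) ¬p = contradiction p ¬p
ind-no (no _) _ = refl

ind-cong : ∀ {p q} {P : Set p} {Q : Set q} (d : Dec P) (e : Dec Q) → P ⇔ Q → ind d ≡ ind e
ind-cong (yes p) e P⇔Q = sym (ind-yes e (to P⇔Q p))
ind-cong (no ¬p) e P⇔Q = sym (ind-no e (¬p ∘ from P⇔Q))

sum-zero : {f : Fin n → ℕ} → (∀ i → f i ≡ 0) → sum f ≡ 0
sum-zero {n} f≗0 = trans (sum-cong-≗ f≗0) (sum-replicate-zero n)

sum-count-≤ : ∀ n k → sum {n} (λ j → ind (k ≤? toℕ j)) ≡ n ∸ k
sum-count-≤ zero    k       = sym (ℕₚ.0∸n≡0 k)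
sum-count-≤ (suc n) zero    = cong suc (sum-count-≤ n zero)
sum-count-≤ (suc n) (suc k) =
  trans (sum-cong-≗ {n} λ j → ind-cong (suc k ≤? suc (toℕ j)) (k ≤? toℕ j) (mk⇔ s≤s⁻¹ s≤s)) (sum-count-≤ n k)

module _ {a p} {A : Set a} {P : Pred A p} (P? : Decidable P) where

  length-filter-tabulate : (f : Fin n → A) → length (filter P? (List.tabulate f)) ≡ sum (ind ∘ P? ∘ f)
  length-filter-tabulate {zero}  f = refl
  length-filter-tabulate {suc n} f with P? (f Fin.zero)
  ... | yes _ = cong suc (length-filter-tabulate (f ∘ Fin.suc))
  ... | no _  = length-filter-tabulate (f ∘ Fin.suc)

length-filter-cartesianProduct : ∀ {a b p} {A : Set a} {B : Set b} {P : Pred (A × B) p} (P? : Decidable P)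
  (f : Fin m → A) (g : Fin n → B) →
  length (filter P? (cartesianProduct (List.tabulate f) (List.tabulate g)))
    ≡ sum (λ q → sum (λ p → ind (P? (f q , g p))))
length-filter-cartesianProduct {zero}  P? f g = refl
length-filter-cartesianProduct {suc m} P? f g = begin
  length (filter P? (map (f Fin.zero ,_) (List.tabulate g) ++ rest))
    ≡⟨ cong length (Listₚ.filter-++ P? (map (f Fin.zero ,_) (List.tabulate g)) rest) ⟩
  length (filter P? (map (f Fin.zero ,_) (List.tabulate g)) ++ filter P? rest)
    ≡⟨ Listₚ.length-++ (filter P? (map (f Fin.zero ,_) (List.tabulate g))) ⟩
  length (filter P? (map (f Fin.zero ,_) (List.tabulate g))) + length (filter P? rest)
    ≡⟨ cong₂ _+_ (trans (cong (length ∘ filter P?) (Listₚ.map-tabulate g (f Fin.zero ,_)))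
                        (length-filter-tabulate P? (λ p → f Fin.zero , g p)))
                 (length-filter-cartesianProduct P? (f ∘ Fin.suc) g) ⟩
  sum (λ q → sum (λ p → ind (P? (f q , g p)))) ∎
  where
  open ≡-Reasoning
  rest = cartesianProduct (List.tabulate (f ∘ Fin.suc)) (List.tabulate g)

-- Inversion counts and insertion of the maximum

InversionAt : (Fin n → Fin n) → Fin n → Fin n → Fin n → Set
InversionAt u i q p = toℕ q < toℕ p × u q ≡ i × toℕ (u p) < toℕ i

inversionAt? : (u : Fin n → Fin n) (i q p : Fin n) → Dec (InversionAt u i q p)
inversionAt? u i q p = (toℕ q <? toℕ p) ×-dec ((u q ≟ i) ×-dec (toℕ (u p) <? toℕ i))

inversionCount : (Fin n → Fin n) → Fin n → ℕ
inversionCount u i = sum (λ q → sum (λ p → ind (inversionAt? u i q p)))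

-- inversionAt? is the predicate filtered in invSeq, and allFin n = tabulate id.
invSeq≡inversionCount : (w : Vec (Fin n) n) (i : Fin n) → invSeq w i ≡ inversionCount (lookup w) i
invSeq≡inversionCount {n} w i =
  length-filter-cartesianProduct {n} {n} (λ (q , p) → inversionAt? (lookup w) i q p) id id

inversionCount-cong : {u v : Fin n → Fin n} → u ≗ v → inversionCount u ≗ inversionCount v
inversionCount-cong {n} u≗v i = sum-cong-≗ {n} λ q → sum-cong-≗ {n} λ p →
  cong₂ (λ x y → ind ((toℕ q <? toℕ p) ×-dec ((x ≟ i) ×-dec (toℕ y <? toℕ i)))) (u≗v q) (u≗v p)

insertMax : Fin (suc n) → (Fin n → Fin n) → Fin (suc n) → Fin (suc n)
insertMax {n} p u x with p ≟ x
... | yes _   = fromℕ n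
... | no p≢x = inject₁ (u (punchOut p≢x))

insertMax-here : (p : Fin (suc n)) (u : Fin n → Fin n) → insertMax p u p ≡ fromℕ n
insertMax-here p u with p ≟ p
... | yes _   = refl
... | no p≢p = contradiction refl p≢p

insertMax-punchIn : (p : Fin (suc n)) (u : Fin n → Fin n) (j : Fin n) →
                    insertMax p u (punchIn p j) ≡ inject₁ (u j)
insertMax-punchIn p u j with p ≟ punchIn p j
... | yes p≡pj = contradiction (sym p≡pj) (Finₚ.punchInᵢ≢i p j)
... | no p≢pj  = cong (inject₁ ∘ u) (Finₚ.punchOut-punchIn p)

insertMax-cong : (p : Fin (suc n)) {u v : Fin n → Fin n} → u ≗ v → insertMax p u ≗ insertMax p v
insertMax-cong p u≗v x with p ≟ x
... | yes _   = refl
... | no p≢x = cong inject₁ (u≗v (punchOut p≢x))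

toℕ-insertMax< : (p : Fin (suc n)) (u : Fin n → Fin n) {x : Fin (suc n)} → p ≢ x →
                 toℕ (insertMax p u x) < n
toℕ-insertMax< p u {x} p≢x with p ≟ x
... | yes p≡x = contradiction p≡x p≢x
... | no p≢x  = subst (_< _) (sym (Finₚ.toℕ-inject₁ _)) (Finₚ.toℕ<n _)

insertMax-injective : (p : Fin (suc n)) {u : Fin n → Fin n} → Injective _≡_ _≡_ u →
                      Injective _≡_ _≡_ (insertMax p u)
insertMax-injective p {u} u-inj {x} {y} eq with p ≟ x | p ≟ y
... | yes p≡x | yes p≡y = trans (sym p≡x) p≡y
... | yes _   | no _    = contradiction eq Finₚ.fromℕ≢inject₁
... | no _    | yes _   = contradiction (sym eq) Finₚ.fromℕ≢inject₁
... | no p≢x  | no p≢y  = Finₚ.punchOut-injective p≢x p≢y (u-inj (Finₚ.inject₁-injective eq))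

injective⇒surjective : {u : Fin n → Fin n} → Injective _≡_ _≡_ u → ∀ i → ∃ λ q → u q ≡ i
injective⇒surjective {suc n} {u} u-inj i with Finₚ.any? (λ q → u q ≟ i)
... | yes hit = hit
... | no ¬hit = contradiction (Finₚ.injective⇒≤ punchOut∘u-injective) ℕₚ.1+n≰n
  where
  i≢u : ∀ q → i ≢ u q
  i≢u q i≡uq = ¬hit (q , sym i≡uq)
  punchOut∘u-injective : Injective _≡_ _≡_ (λ q → punchOut (i≢u q))
  punchOut∘u-injective eq = u-inj (Finₚ.punchOut-injective (i≢u _) (i≢u _) eq)

insertMax-surjective : {u : Fin (suc n) → Fin (suc n)} → Injective _≡_ _≡_ u →
                       ∃ λ p → ∃ λ v → Injective _≡_ _≡_ v × insertMax p v ≗ u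
insertMax-surjective {n} {u} u-inj = p , v , v-injective , insertMax-v
  where
  p = proj₁ (injective⇒surjective u-inj (fromℕ n))
  up≡max : u p ≡ fromℕ n
  up≡max = proj₂ (injective⇒surjective u-inj (fromℕ n))
  n≢ : ∀ j → n ≢ toℕ (u (punchIn p j))
  n≢ j n≡ = Finₚ.punchInᵢ≢i p j (u-inj (trans u[pj]≡max (sym up≡max)))
    where u[pj]≡max = Finₚ.toℕ-injective (trans (sym n≡) (sym (Finₚ.toℕ-fromℕ n)))
  v : Fin n → Fin n
  v j = lower₁ (u (punchIn p j)) (n≢ j)
  v-injective : Injective _≡_ _≡_ v
  v-injective eq = Finₚ.punchIn-injective p _ _ (u-inj (Finₚ.lower₁-injective eq))
  insertMax-v : insertMax p v ≗ u
  insertMax-v x with p ≟ x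
  ... | yes p≡x = trans (sym up≡max) (cong u p≡x)
  ... | no p≢x  = trans (Finₚ.inject₁-lower₁ _ _) (cong u (Finₚ.punchIn-punchOut p≢x))

punchIn-<-⇔ : (p : Fin (suc n)) {j k : Fin n} → toℕ (punchIn p j) < toℕ (punchIn p k) ⇔ toℕ j < toℕ k
punchIn-<-⇔ p {j} {k} = mk⇔
  (λ lt → ℕₚ.≰⇒> λ k≤j → ℕₚ.<⇒≱ lt (Finₚ.punchIn-mono-≤ p k j k≤j))
  (λ lt → ℕₚ.≰⇒> λ pk≤pj → ℕₚ.<⇒≱ lt (Finₚ.punchIn-cancel-≤ p k j pk≤pj))

module _ (p : Fin (suc n)) (u : Fin n → Fin n) where
  open ≡-Reasoning

  private
    w = insertMax p u
    sum-remove-at-p : (f : Fin (suc n) → ℕ) → sum f ≡ f p + sum (f ∘ punchIn p)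
    sum-remove-at-p f = sum-remove {i = p} f

  inversionCount-insertMax-inject₁ : ∀ i → inversionCount w (inject₁ i) ≡ inversionCount u i
  inversionCount-insertMax-inject₁ i = begin
    inversionCount w (inject₁ i)
      ≡⟨ sum-remove-at-p (λ q → sum (term q)) ⟩
    sum (term p) + sum (λ j → sum (term (punchIn p j)))
      ≡⟨ cong₂ _+_ (sum-zero λ q → ind-no (inversionAt? w (inject₁ i) p q) (max≢inject₁ ∘ proj₁ ∘ proj₂))
                   (sum-cong-≗ {n} λ j → sum-remove-at-p (term (punchIn p j))) ⟩
    sum (λ j → term (punchIn p j) p + sum (term (punchIn p j) ∘ punchIn p))
      ≡⟨ sum-cong-≗ {n} (λ j → cong₂ _+_
           (ind-no (inversionAt? w (inject₁ i) (punchIn p j) p) (max≮inject₁ ∘ proj₂ ∘ proj₂))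
           (sum-cong-≗ {n} λ k → ind-cong _ _ (punchIn-<-⇔ p ×-⇔ (value-⇔ j ×-⇔ less-⇔ k)))) ⟩
    inversionCount u i ∎
    where
    term : Fin (suc n) → Fin (suc n) → ℕ
    term q r = ind (inversionAt? w (inject₁ i) q r)
    max≢inject₁ : w p ≢ inject₁ i
    max≢inject₁ eq = Finₚ.fromℕ≢inject₁ (trans (sym (insertMax-here p u)) eq)
    max≮inject₁ : ¬ (toℕ (w p) < toℕ (inject₁ i))
    max≮inject₁ lt = ℕₚ.<-asym (Finₚ.toℕ<n i)
      (subst₂ _<_ (trans (cong toℕ (insertMax-here p u)) (Finₚ.toℕ-fromℕ n)) (Finₚ.toℕ-inject₁ i) lt)
    value-⇔ : ∀ j → (w (punchIn p j) ≡ inject₁ i) ⇔ (u j ≡ i)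
    value-⇔ j = mk⇔ (λ eq → Finₚ.inject₁-injective (trans (sym (insertMax-punchIn p u j)) eq))
                    (λ eq → trans (insertMax-punchIn p u j) (cong inject₁ eq))
    less-⇔ : ∀ k → toℕ (w (punchIn p k)) < toℕ (inject₁ i) ⇔ toℕ (u k) < toℕ i
    less-⇔ k = mk⇔ (subst₂ _<_ eq (Finₚ.toℕ-inject₁ i)) (subst₂ _<_ (sym eq) (sym (Finₚ.toℕ-inject₁ i)))
      where eq = trans (cong toℕ (insertMax-punchIn p u k)) (Finₚ.toℕ-inject₁ (u k))

  inversionCount-insertMax-fromℕ : inversionCount w (fromℕ n) ≡ n ∸ toℕ p
  inversionCount-insertMax-fromℕ = begin
    inversionCount w (fromℕ n)
      ≡⟨ sum-remove-at-p (λ q → sum (term q)) ⟩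
    sum (term p) + sum (λ j → sum (term (punchIn p j)))
      ≡⟨ cong₂ _+_ (sum-cong-≗ {suc n} λ r →
                      ind-cong (inversionAt? w (fromℕ n) p r) (toℕ p <? toℕ r) (after-⇔ r))
                   (sum-zero {n} λ j → sum-zero λ r → ind-no (inversionAt? w (fromℕ n) (punchIn p j) r)
                                                         (inject₁≢max j ∘ proj₁ ∘ proj₂)) ⟩
    sum {suc n} (λ r → ind (toℕ p <? toℕ r)) + 0
      ≡⟨ ℕₚ.+-identityʳ _ ⟩
    sum {suc n} (λ r → ind (suc (toℕ p) ≤? toℕ r))
      ≡⟨ sum-count-≤ (suc n) (suc (toℕ p)) ⟩
    n ∸ toℕ p ∎
    where
    term : Fin (suc n) → Fin (suc n) → ℕ
    term q r = ind (inversionAt? w (fromℕ n) q r)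
    after-⇔ : ∀ r → InversionAt w (fromℕ n) p r ⇔ toℕ p < toℕ r
    after-⇔ r = mk⇔ proj₁ λ lt →
      lt , insertMax-here p u ,
      subst (toℕ (w r) <_) (sym (Finₚ.toℕ-fromℕ n))
            (toℕ-insertMax< p u (λ p≡r → ℕₚ.<-irrefl (cong toℕ p≡r) lt))
    inject₁≢max : ∀ j → w (punchIn p j) ≢ fromℕ n
    inject₁≢max j eq = Finₚ.fromℕ≢inject₁ (sym (trans (sym (insertMax-punchIn p u j)) eq))

-- The inversion sequence is a bijection onto codes

IsCode : (Fin n → ℕ) → Set
IsCode c = ∀ i → c i ≤ toℕ i

fromℕ-or-inject₁ : (i : Fin (suc n)) → i ≡ fromℕ n ⊎ ∃ λ j → i ≡ inject₁ j
fromℕ-or-inject₁ {n} i with n ℕₚ.≟ toℕ i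
... | yes n≡i = inj₁ (Finₚ.toℕ-injective (trans (sym n≡i) (sym (Finₚ.toℕ-fromℕ n))))
... | no n≢i  = inj₂ (lower₁ i n≢i , sym (Finₚ.inject₁-lower₁ i n≢i))

-- Inserting the maximum at position n ∸ x gives it the inversion count x.
maxPosition : (Fin (suc n) → ℕ) → Fin (suc n)
maxPosition {n} c = fromℕ< (s≤s (ℕₚ.m∸n≤m n (c (fromℕ n))))

decode : (Fin n → ℕ) → Fin n → Fin n
decode {zero}  c ()
decode {suc n} c = insertMax (maxPosition c) (decode (c ∘ inject₁))

decode-injective : (c : Fin n → ℕ) → Injective _≡_ _≡_ (decode c)
decode-injective {zero}  c {()}
decode-injective {suc n} c = insertMax-injective (maxPosition c) (decode-injective (c ∘ inject₁))

inversionCount-decode : {c : Fin n → ℕ} → IsCode c → inversionCount (decode c) ≗ c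
inversionCount-decode {suc n} {c} c-code i with fromℕ-or-inject₁ i
... | inj₁ refl = begin
  inversionCount (decode c) (fromℕ n)
    ≡⟨ inversionCount-insertMax-fromℕ (maxPosition c) (decode (c ∘ inject₁)) ⟩
  n ∸ toℕ (maxPosition c)
    ≡⟨ cong (n ∸_) (Finₚ.toℕ-fromℕ< (s≤s (ℕₚ.m∸n≤m n (c (fromℕ n))))) ⟩
  n ∸ (n ∸ c (fromℕ n))
    ≡⟨ ℕₚ.m∸[m∸n]≡n c-last≤n ⟩
  c (fromℕ n) ∎
  where
  open ≡-Reasoning
  c-last≤n = subst (c (fromℕ n) ≤_) (Finₚ.toℕ-fromℕ n) (c-code (fromℕ n))
... | inj₂ (j , refl) =
  trans (inversionCount-insertMax-inject₁ (maxPosition c) (decode (c ∘ inject₁)) j)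
        (inversionCount-decode (λ k → subst (c (inject₁ k) ≤_) (Finₚ.toℕ-inject₁ k) (c-code (inject₁ k))) j)

inversionCount-isCode : {u : Fin n → Fin n} → Injective _≡_ _≡_ u → IsCode (inversionCount u)
inversionCount-isCode {suc n} {u} u-inj i
  with p , v , v-inj , insert≗u ← insertMax-surjective u-inj =
  subst (_≤ toℕ i) (inversionCount-cong insert≗u i) (bound i)
  where
  bound : IsCode (inversionCount (insertMax p v))
  bound i with fromℕ-or-inject₁ i
  ... | inj₁ refl = subst₂ _≤_ (sym (inversionCount-insertMax-fromℕ p v)) (sym (Finₚ.toℕ-fromℕ n))
                           (ℕₚ.m∸n≤m n (toℕ p))
  ... | inj₂ (j , refl) = subst₂ _≤_ (sym (inversionCount-insertMax-inject₁ p v j)) (sym (Finₚ.toℕ-inject₁ j))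
                                 (inversionCount-isCode v-inj j)

inversionCount-injective : {u v : Fin n → Fin n} → Injective _≡_ _≡_ u → Injective _≡_ _≡_ v →
                           inversionCount u ≗ inversionCount v → u ≗ v
inversionCount-injective {suc n} {u} {v} u-inj v-inj same x
  with p , u′ , u′-inj , insert≗u ← insertMax-surjective u-inj
     | q , v′ , v′-inj , insert≗v ← insertMax-surjective v-inj = begin
  u x                  ≡⟨ sym (insert≗u x) ⟩
  insertMax p u′ x     ≡⟨ cong (λ r → insertMax r u′ x) p≡q ⟩
  insertMax q u′ x     ≡⟨ insertMax-cong q (inversionCount-injective u′-inj v′-inj same′) x ⟩
  insertMax q v′ x     ≡⟨ insert≗v x ⟩
  v x                  ∎
  where
  open ≡-Reasoning
  same-inserted : inversionCount (insertMax p u′) ≗ inversionCount (insertMax q v′)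
  same-inserted i = trans (inversionCount-cong insert≗u i) (trans (same i) (sym (inversionCount-cong insert≗v i)))
  p≡q : p ≡ q
  p≡q = Finₚ.toℕ-injective (ℕₚ.∸-cancelˡ-≡ (s≤s⁻¹ (Finₚ.toℕ<n p)) (s≤s⁻¹ (Finₚ.toℕ<n q))
    (trans (sym (inversionCount-insertMax-fromℕ p u′))
           (trans (same-inserted (fromℕ n)) (inversionCount-insertMax-fromℕ q v′))))
  same′ : inversionCount u′ ≗ inversionCount v′
  same′ j = trans (sym (inversionCount-insertMax-inject₁ p u′ j))
                  (trans (same-inserted (inject₁ j)) (inversionCount-insertMax-inject₁ q v′ j))

fromInvSeq : (Fin n → ℕ) → Vec (Fin n) n
fromInvSeq c = tabulate (decode c)

fromInvSeq-isPerm : (c : Fin n → ℕ) → IsPerm (fromInvSeq c)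
fromInvSeq-isPerm c i j eq =
  decode-injective c (trans (sym (Vecₚ.lookup∘tabulate (decode c) i))
                            (trans eq (Vecₚ.lookup∘tabulate (decode c) j)))

invSeq-fromInvSeq : {c : Fin n → ℕ} → IsCode c → ∀ i → invSeq (fromInvSeq c) i ≡ c i
invSeq-fromInvSeq {c = c} c-code i =
  trans (invSeq≡inversionCount (fromInvSeq c) i)
        (trans (inversionCount-cong (Vecₚ.lookup∘tabulate (decode c)) i) (inversionCount-decode c-code i))

invSeq-isCode : (w : Vec (Fin n) n) → IsPerm w → IsCode (invSeq w)
invSeq-isCode w w-perm i =
  subst (_≤ toℕ i) (sym (invSeq≡inversionCount w i)) (inversionCount-isCode (w-perm _ _) i)

invSeq-injective : (v w : Vec (Fin n) n) → IsPerm v → IsPerm w → (∀ i → invSeq v i ≡ invSeq w i) → v ≡ w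
invSeq-injective v w v-perm w-perm same = begin
  v                   ≡⟨ Vecₚ.tabulate∘lookup v ⟨
  tabulate (lookup v) ≡⟨ Vecₚ.tabulate-cong (inversionCount-injective (v-perm _ _) (w-perm _ _) same′) ⟩
  tabulate (lookup w) ≡⟨ Vecₚ.tabulate∘lookup w ⟩
  w                   ∎
  where
  open ≡-Reasoning
  same′ : inversionCount (lookup v) ≗ inversionCount (lookup w)
  same′ i = trans (sym (invSeq≡inversionCount v i)) (trans (same i) (invSeq≡inversionCount w i))

fromInvSeq-≗invSeq : (u : Vec (Fin n) n) → IsPerm u → {c : Fin n → ℕ} → c ≗ invSeq u → fromInvSeq c ≡ u
fromInvSeq-≗invSeq u u-perm {c} c≗ =
  invSeq-injective _ u (fromInvSeq-isPerm c) u-perm (λ i → trans (invSeq-fromInvSeq c-code i) (c≗ i))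
  where
  c-code : IsCode c
  c-code i = subst (_≤ toℕ i) (sym (c≗ i)) (invSeq-isCode u u-perm i)

compress : (d : Subset n) → Subset n → Subset ∣ d ∣
compress []            []      = []
compress (inside  ∷ d) (x ∷ t) = x ∷ compress d t
compress (outside ∷ d) (_ ∷ t) = compress d t

expand : (d : Subset n) → Subset ∣ d ∣ → Subset n
expand []            _       = []
expand (inside  ∷ d) (x ∷ s) = x ∷ expand d s
expand (outside ∷ d) s       = outside ∷ expand d s

expand-⊆ : (d : Subset n) (s : Subset ∣ d ∣) → expand d s ⊆ d
expand-⊆ (inside  ∷ d) (x ∷ s) here      = here
expand-⊆ (inside  ∷ d) (x ∷ s) (there m) = there (expand-⊆ d s m)
expand-⊆ (outside ∷ d) s       (there m) = there (expand-⊆ d s m)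

compress-expand : (d : Subset n) (s : Subset ∣ d ∣) → compress d (expand d s) ≡ s
compress-expand []            []      = refl
compress-expand (inside  ∷ d) (x ∷ s) = cong (x ∷_) (compress-expand d s)
compress-expand (outside ∷ d) s       = compress-expand d s

expand-compress : (d t : Subset n) → t ⊆ d → expand d (compress d t) ≡ t
expand-compress []            []            _   = refl
expand-compress (inside  ∷ d) (x ∷ t)       t⊆d = cong (x ∷_) (expand-compress d t (Subsetₚ.drop-∷-⊆ t⊆d))
expand-compress (outside ∷ d) (outside ∷ t) t⊆d = cong (outside ∷_) (expand-compress d t (Subsetₚ.drop-∷-⊆ t⊆d))
expand-compress (outside ∷ d) (inside  ∷ t) t⊆d with () ← t⊆d here

expand-mono : (d : Subset n) {s s′ : Subset ∣ d ∣} → s ⊆ s′ → expand d s ⊆ expand d s′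
expand-mono (inside  ∷ d) {_ ∷ _} {_ ∷ _} s⊆s′ here      with here ← s⊆s′ here = here
expand-mono (inside  ∷ d) {_ ∷ _} {_ ∷ _} s⊆s′ (there m) = there (expand-mono d (Subsetₚ.drop-∷-⊆ s⊆s′) m)
expand-mono (outside ∷ d)                 s⊆s′ (there m) = there (expand-mono d s⊆s′ m)

expand-cancel : (d : Subset n) {s s′ : Subset ∣ d ∣} → expand d s ⊆ expand d s′ → s ⊆ s′
expand-cancel (inside  ∷ d) {_ ∷ _} {_ ∷ _} sub here      with here ← sub here = here
expand-cancel (inside  ∷ d) {_ ∷ _} {_ ∷ _} sub (there m) = there (expand-cancel d (Subsetₚ.drop-∷-⊆ sub) m)
expand-cancel (outside ∷ d)                 sub m         = expand-cancel d (Subsetₚ.drop-∷-⊆ sub) m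

⊈⇒∃∉ : {p q : Subset n} → ¬ (p ⊆ q) → ∃ λ x → x ∈ₛ p × x ∉ₛ q
⊈⇒∃∉ {n} {p} {q} p⊈q
  with x , ¬[x∈p→x∈q] ← Finₚ.¬∀⟶∃¬ n (λ x → x ∈ₛ p → x ∈ₛ q)
                           (λ x → x Subsetₚ.∈? p →-dec x Subsetₚ.∈? q) (λ all → p⊈q (all _))
  with x Subsetₚ.∈? p
... | yes x∈p = x , x∈p , λ x∈q → ¬[x∈p→x∈q] (λ _ → x∈q)
... | no  x∉p = contradiction (λ x∈p → contradiction x∈p x∉p) ¬[x∈p→x∈q]

incomparable-in-interval : {A M T : Subset n} → A ⊆ M → M ⊆ T → ¬ (M ⊆ A) → ¬ (T ⊆ M) →
                           ∃ λ S → A ⊆ S × S ⊆ T × ¬ (S ⊆ M) × ¬ (M ⊆ S)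
incomparable-in-interval {A = A} {M} {T} A⊆M M⊆T M⊈A T⊈M
  with x , x∈M , x∉A ← ⊈⇒∃∉ M⊈A | y , y∈T , y∉M ← ⊈⇒∃∉ T⊈M =
  A ∪ ⁅ y ⁆ , Subsetₚ.p⊆p∪q ⁅ y ⁆ , S⊆T , (λ S⊆M → y∉M (S⊆M y∈S)) , M⊈S
  where
  y∈S : y ∈ₛ A ∪ ⁅ y ⁆
  y∈S = Subsetₚ.x∈p∪q⁺ (inj₂ (Subsetₚ.x∈⁅x⁆ y))
  S⊆T : A ∪ ⁅ y ⁆ ⊆ T
  S⊆T z∈S with Subsetₚ.x∈p∪q⁻ A ⁅ y ⁆ z∈S
  ... | inj₁ z∈A = M⊆T (A⊆M z∈A)
  ... | inj₂ z∈y = subst (_∈ₛ T) (sym (Subsetₚ.x∈⁅y⁆⇒x≡y y z∈y)) y∈T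
  M⊈S : ¬ (M ⊆ A ∪ ⁅ y ⁆)
  M⊈S M⊆S with Subsetₚ.x∈p∪q⁻ A ⁅ y ⁆ (M⊆S x∈M)
  ... | inj₁ x∈A = x∉A x∈A
  ... | inj₂ x∈y = y∉M (subst (_∈ₛ M) (Subsetₚ.x∈⁅y⁆⇒x≡y y x∈y) x∈M)

does≡true⇔ : ∀ {p} {P : Set p} (d : Dec P) → does d ≡ true ⇔ P
does≡true⇔ (yes p) = mk⇔ (λ _ → p) (λ _ → refl)
does≡true⇔ (no ¬p) = mk⇔ (λ ()) (λ p → contradiction p ¬p)

∈-tabulate⇔ : (f : Fin n → Side) {i : Fin n} → i ∈ₛ tabulate f ⇔ f i ≡ inside
∈-tabulate⇔ f {i} = mk⇔ (λ i∈ → trans (sym (Vecₚ.lookup∘tabulate f i)) (Vecₚ.[]=⇒lookup i∈))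
                       (λ fi≡ → Vecₚ.lookup⇒[]= i (tabulate f) (trans (Vecₚ.lookup∘tabulate f i) fi≡))

-- Boolean intervals of the middle order

infix 4 _≤ᶜ_
_≤ᶜ_ : (Fin n → ℕ) → (Fin n → ℕ) → Set
c ≤ᶜ c′ = ∀ i → c i ≤ c′ i

excess : (a c : Fin n → ℕ) → Subset n
excess a c = tabulate (λ i → does (a i <? c i))

∈-excess⇔ : (a c : Fin n → ℕ) {i : Fin n} → i ∈ₛ excess a c ⇔ a i < c i
∈-excess⇔ a c {i} = ⇔.trans (∈-tabulate⇔ (λ j → does (a j <? c j))) (does≡true⇔ (a i <? c i))

raise : (Fin n → ℕ) → Subset n → Fin n → ℕ
raise a s i = a i + ind (i Subsetₚ.∈? s)

<-raise⇔ : (a : Fin n → ℕ) (s : Subset n) {i : Fin n} → a i < raise a s i ⇔ i ∈ₛ s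
<-raise⇔ a s {i} with i Subsetₚ.∈? s
... | yes i∈s = mk⇔ (λ _ → i∈s) (λ _ → subst (a i <_) (ℕₚ.+-comm 1 (a i)) (ℕₚ.n<1+n (a i)))
... | no  i∉s = mk⇔ (λ lt → contradiction (subst (a i <_) (ℕₚ.+-identityʳ (a i)) lt) (ℕₚ.<-irrefl refl))
                   (λ i∈s → contradiction i∈s i∉s)

excess-raise : (a : Fin n → ℕ) (s : Subset n) → excess a (raise a s) ≡ s
excess-raise a s = Subsetₚ.⊆-antisym
  (to (<-raise⇔ a s) ∘ to (∈-excess⇔ a (raise a s)))
  (from (∈-excess⇔ a (raise a s)) ∘ from (<-raise⇔ a s))

module _ {a : Fin n → ℕ} where

  raise-excess : {c : Fin n → ℕ} → a ≤ᶜ c → c ≤ᶜ suc ∘ a → raise a (excess a c) ≗ c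
  raise-excess {c} a≤c c≤1+a i with i Subsetₚ.∈? excess a c
  ... | yes i∈ = trans (ℕₚ.+-comm (a i) 1) (ℕₚ.≤-antisym (to (∈-excess⇔ a c) i∈) (c≤1+a i))
  ... | no  i∉ = trans (ℕₚ.+-identityʳ (a i)) (ℕₚ.≤-antisym (a≤c i) (ℕₚ.≮⇒≥ (i∉ ∘ from (∈-excess⇔ a c))))

  excess-mono : {c c′ : Fin n → ℕ} → c ≤ᶜ c′ → excess a c ⊆ excess a c′
  excess-mono {c} {c′} c≤c′ {i} i∈ =
    from (∈-excess⇔ a c′) (ℕₚ.<-≤-trans (to (∈-excess⇔ a c) i∈) (c≤c′ i))

  excess-cancel : {c c′ : Fin n → ℕ} → c ≤ᶜ suc ∘ a → a ≤ᶜ c′ → excess a c ⊆ excess a c′ → c ≤ᶜ c′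
  excess-cancel {c} {c′} c≤1+a a≤c′ sub i with a i <? c i
  ... | yes a<c = ℕₚ.≤-trans (c≤1+a i) (to (∈-excess⇔ a c′) (sub (from (∈-excess⇔ a c) a<c)))
  ... | no  a≮c = ℕₚ.≤-trans (ℕₚ.≮⇒≥ a≮c) (a≤c′ i)

  raise-≤ᶜ : {b : Fin n → ℕ} {s : Subset n} → a ≤ᶜ b → s ⊆ excess a b → raise a s ≤ᶜ b
  raise-≤ᶜ {b} {s} a≤b s⊆ i with i Subsetₚ.∈? s
  ... | yes i∈s = subst (_≤ b i) (ℕₚ.+-comm 1 (a i)) (to (∈-excess⇔ a b) (s⊆ i∈s))
  ... | no  _   = subst (_≤ b i) (sym (ℕₚ.+-identityʳ (a i))) (a≤b i)

excess-cong : (a : Fin n → ℕ) {c c′ : Fin n → ℕ} → c ≗ c′ → excess a c ≡ excess a c′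
excess-cong a c≗c′ = Vecₚ.tabulate-cong λ i → cong (λ x → does (a i <? x)) (c≗c′ i)

module _ {v w : Vec (Fin n) n} (w-perm : IsPerm w) {c : Fin n → ℕ}
         (v≤c : invSeq v ≤ᶜ c) (c≤w : c ≤ᶜ invSeq w) where

  invSeq-intervalElem : ∀ i → invSeq (fromInvSeq c) i ≡ c i
  invSeq-intervalElem = invSeq-fromInvSeq (λ i → ℕₚ.≤-trans (c≤w i) (invSeq-isCode w w-perm i))

  intervalElem : Elem v w
  intervalElem = fromInvSeq c , fromInvSeq-isPerm c
               , (λ i → subst (invSeq v i ≤_) (sym (invSeq-intervalElem i)) (v≤c i))
               , (λ i → subst (_≤ invSeq w i) (sym (invSeq-intervalElem i)) (c≤w i))

module _ {v w : Vec (Fin n) n} (w-perm : IsPerm w) (v≼w : v ≼ w) (thin : invSeq w ≤ᶜ suc ∘ invSeq v) where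

  -- [v , w] ≅ subsets of d (through excess) ≅ Subset ∣ d ∣ (through compress and expand).
  private
    a = invSeq v
    d = excess a (invSeq w)

    code : Elem v w → Fin n → ℕ
    code e = invSeq (proj₁ e)

    code-thin : ∀ e → code e ≤ᶜ suc ∘ a
    code-thin (_ , _ , _ , u≼w) i = ℕₚ.≤-trans (u≼w i) (thin i)

    toSubset : Elem v w → Subset ∣ d ∣
    toSubset e = compress d (excess a (code e))

    a≤raise : ∀ s → a ≤ᶜ raise a (expand d s)
    a≤raise s i = ℕₚ.m≤m+n (a i) _

    raise≤b : ∀ s → raise a (expand d s) ≤ᶜ invSeq w
    raise≤b s = raise-≤ᶜ v≼w (expand-⊆ d s)

    fromSubset : Subset ∣ d ∣ → Elem v w
    fromSubset s = intervalElem {v = v} {w = w} w-perm (a≤raise s) (raise≤b s)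

    invSeq-fromSubset : ∀ s i → invSeq (proj₁ (fromSubset s)) i ≡ raise a (expand d s) i
    invSeq-fromSubset s = invSeq-intervalElem {v = v} {w = w} w-perm (a≤raise s) (raise≤b s)

    expand-toSubset : ∀ e → expand d (toSubset e) ≡ excess a (code e)
    expand-toSubset e@(_ , _ , _ , u≼w) = expand-compress d (excess a (code e)) (excess-mono u≼w)

    from-to : ∀ e → proj₁ (fromSubset (toSubset e)) ≡ proj₁ e
    from-to e@(u , u-perm , v≼u , _) = invSeq-injective _ u (fromInvSeq-isPerm _) u-perm λ i → begin
      invSeq (proj₁ (fromSubset (toSubset e))) i ≡⟨ invSeq-fromSubset (toSubset e) i ⟩
      raise a (expand d (toSubset e)) i         ≡⟨ cong (λ t → raise a t i) (expand-toSubset e) ⟩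
      raise a (excess a (code e)) i             ≡⟨ raise-excess v≼u (code-thin e) i ⟩
      code e i                                  ∎
      where open ≡-Reasoning

    to-from : ∀ s → toSubset (fromSubset s) ≡ s
    to-from s = begin
      compress d (excess a (code (fromSubset s)))   ≡⟨ cong (compress d) (excess-cong a (invSeq-fromSubset s)) ⟩
      compress d (excess a (raise a (expand d s)))  ≡⟨ cong (compress d) (excess-raise a (expand d s)) ⟩
      compress d (expand d s)                       ≡⟨ compress-expand d s ⟩
      s                                             ∎
      where open ≡-Reasoning

    order : ∀ e e′ → proj₁ e ≼ proj₁ e′ ⇔ toSubset e ⊆ toSubset e′
    order e e′@(_ , _ , v≼u′ , _) = ⇔.trans
      (mk⇔ excess-mono (excess-cancel (code-thin e) v≼u′))
      (subst₂ (λ t t′ → (t ⊆ t′) ⇔ (toSubset e ⊆ toSubset e′)) (expand-toSubset e) (expand-toSubset e′)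
              (mk⇔ (expand-cancel d) (expand-mono d)))

  thin⇒isBoolean : IsBoolean v w
  thin⇒isBoolean = ∣ d ∣ , toSubset , fromSubset , from-to , to-from , order

at-and-off : {P : Fin n → Set} (i : Fin n) → P i → (∀ j → j ≢ i → P j) → ∀ j → P j
at-and-off i Pᵢ off j with j ≟ i
... | yes refl = Pᵢ
... | no  j≢i  = off j j≢i

line-comparable : {a c m t : Fin n → ℕ} (i : Fin n) → a ≤ᶜ c → c ≤ᶜ t →
                  (∀ j → j ≢ i → t j ≡ a j) → (∀ j → j ≢ i → m j ≡ a j) → c ≤ᶜ m ⊎ m ≤ᶜ c
line-comparable {a = a} {c} {m} {t} i a≤c c≤t t-off m-off with ℕₚ.≤-total (c i) (m i)
... | inj₁ cᵢ≤mᵢ = inj₁ (at-and-off i cᵢ≤mᵢ λ j j≢i →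
                     subst (c j ≤_) (trans (t-off j j≢i) (sym (m-off j j≢i))) (c≤t j))
... | inj₂ mᵢ≤cᵢ = inj₂ (at-and-off i mᵢ≤cᵢ λ j j≢i → subst (_≤ c j) (sym (m-off j j≢i)) (a≤c j))

isBoolean⇒thin : {v w : Vec (Fin n) n} → IsPerm v → IsPerm w → v ≼ w → IsBoolean v w →
                 invSeq w ≤ᶜ suc ∘ invSeq v
isBoolean⇒thin {n} {v} {w} v-perm w-perm v≼w (_ , f , g , _ , f∘g , order) i = ℕₚ.≮⇒≥ gap<2
  where
  a = invSeq v

  bump : ℕ → Fin n → ℕ
  bump k = updateAt a i (_+ k)

  bump-at : ∀ k → bump k i ≡ a i + k
  bump-at k = Vectorₚ.updateAt-updates i a

  bump-off : ∀ k j → j ≢ i → bump k j ≡ a j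
  bump-off k j j≢i = Vectorₚ.updateAt-minimal j i a j≢i

  a≤bump : ∀ k → a ≤ᶜ bump k
  a≤bump k = at-and-off i (subst (a i ≤_) (sym (bump-at k)) (ℕₚ.m≤m+n (a i) k))
                          (λ j j≢i → ℕₚ.≤-reflexive (sym (bump-off k j j≢i)))

  gap<2 : ¬ (suc (a i) < invSeq w i)
  gap<2 2+aᵢ≤bᵢ = comparable⇒⊥ (incomparable-in-interval
    (to (order bottom middle) v≼middle) (to (order middle top) middle≼top)
    (middle⋠bottom ∘ from (order middle bottom)) (top⋠middle ∘ from (order top middle)))
    where
    bump≤b : ∀ {k} → k ≤ 2 → bump k ≤ᶜ invSeq w
    bump≤b {k} k≤2 = at-and-off i
      (subst (_≤ invSeq w i) (sym (bump-at k))
             (ℕₚ.≤-trans (ℕₚ.+-monoʳ-≤ (a i) k≤2) (subst (_≤ invSeq w i) (ℕₚ.+-comm 2 (a i)) 2+aᵢ≤bᵢ)))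
      (λ j j≢i → subst (_≤ invSeq w j) (sym (bump-off k j j≢i)) (v≼w j))

    middle top : Elem v w
    middle = intervalElem {v = v} {w = w} w-perm (a≤bump 1) (bump≤b (s≤s z≤n))
    top    = intervalElem {v = v} {w = w} w-perm (a≤bump 2) (bump≤b ℕₚ.≤-refl)

    bottom : Elem v w
    bottom = v , v-perm , (λ _ → ℕₚ.≤-refl) , v≼w

    invSeq-middle : ∀ j → invSeq (proj₁ middle) j ≡ bump 1 j
    invSeq-middle = invSeq-intervalElem {v = v} {w = w} w-perm (a≤bump 1) (bump≤b (s≤s z≤n))
    invSeq-top : ∀ j → invSeq (proj₁ top) j ≡ bump 2 j
    invSeq-top = invSeq-intervalElem {v = v} {w = w} w-perm (a≤bump 2) (bump≤b ℕₚ.≤-refl)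

    v≼middle : v ≼ proj₁ middle
    v≼middle j = subst (a j ≤_) (sym (invSeq-middle j)) (a≤bump 1 j)

    middle≼top : proj₁ middle ≼ proj₁ top
    middle≼top = at-and-off i
      (subst₂ _≤_ (sym (trans (invSeq-middle i) (bump-at 1))) (sym (trans (invSeq-top i) (bump-at 2)))
                  (ℕₚ.+-monoʳ-≤ (a i) (s≤s z≤n)))
      (λ j j≢i → ℕₚ.≤-reflexive (trans (trans (invSeq-middle j) (bump-off 1 j j≢i))
                                       (sym (trans (invSeq-top j) (bump-off 2 j j≢i)))))

    middle⋠bottom : ¬ (proj₁ middle ≼ v)
    middle⋠bottom m≼v =
      ℕₚ.1+n≰n (subst (_≤ a i) (trans (trans (invSeq-middle i) (bump-at 1)) (ℕₚ.+-comm (a i) 1)) (m≼v i))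

    top⋠middle : ¬ (proj₁ top ≼ proj₁ middle)
    top⋠middle t≼m with s≤s () ← ℕₚ.+-cancelˡ-≤ (a i) 2 1
      (subst₂ _≤_ (trans (invSeq-top i) (bump-at 2)) (trans (invSeq-middle i) (bump-at 1)) (t≼m i))

    comparable⇒⊥ : (∃ λ S → f bottom ⊆ S × S ⊆ f top × ¬ (S ⊆ f middle) × ¬ (f middle ⊆ S)) → ⊥
    comparable⇒⊥ (S , A⊆S , S⊆T , S⊈M , M⊈S) =
      [ S⊈M ∘ subst (_⊆ f middle) (f∘g S) ∘ to (order (g S) middle)
      , M⊈S ∘ subst (f middle ⊆_) (f∘g S) ∘ to (order middle (g S))
      ]′ (line-comparable i v≼u u≼t (λ j j≢i → trans (invSeq-top j) (bump-off 2 j j≢i))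
                                   (λ j j≢i → trans (invSeq-middle j) (bump-off 1 j j≢i)))
      where
      v≼u : v ≼ proj₁ (g S)
      v≼u = from (order bottom (g S)) (subst (f bottom ⊆_) (sym (f∘g S)) A⊆S)
      u≼t : proj₁ (g S) ≼ proj₁ top
      u≼t = from (order (g S) top) (subst (_⊆ f top) (sym (f∘g S)) S⊆T)

booleanInterval⇔ : {v w : Vec (Fin n) n} →
                   BooleanInterval v w ⇔ (IsPerm v × IsPerm w × v ≼ w × invSeq w ≤ᶜ suc ∘ invSeq v)
booleanInterval⇔ {v = v} {w} = mk⇔
  (λ (v-perm , w-perm , v≼w , boolean) →
     v-perm , w-perm , v≼w , isBoolean⇒thin {v = v} {w} v-perm w-perm v≼w boolean)
  (λ (v-perm , w-perm , v≼w , thin) →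
     v-perm , w-perm , v≼w , thin⇒isBoolean {v = v} {w} w-perm v≼w thin)

-- Enumeration

lookup-∷ʳ-fromℕ : ∀ {a} {A : Set a} (xs : Vec A n) (x : A) → lookup (xs ∷ʳ x) (fromℕ n) ≡ x
lookup-∷ʳ-fromℕ []       x = refl
lookup-∷ʳ-fromℕ (_ ∷ xs) x = lookup-∷ʳ-fromℕ xs x

lookup-∷ʳ-inject₁ : ∀ {a} {A : Set a} (xs : Vec A n) (x : A) (i : Fin n) →
                    lookup (xs ∷ʳ x) (inject₁ i) ≡ lookup xs i
lookup-∷ʳ-inject₁ (_ ∷ xs) x Fin.zero    = refl
lookup-∷ʳ-inject₁ (_ ∷ xs) x (Fin.suc i) = lookup-∷ʳ-inject₁ xs x i

length-cartesianProductWith : ∀ {a b c} {A : Set a} {B : Set b} {C : Set c}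
                              (f : A → B → C) (xs : List A) (ys : List B) →
                              length (cartesianProductWith f xs ys) ≡ length xs * length ys
length-cartesianProductWith f List.[]       ys = refl
length-cartesianProductWith f (x List.∷ xs) ys = begin
  length (map (f x) ys ++ cartesianProductWith f xs ys)     ≡⟨ Listₚ.length-++ (map (f x) ys) ⟩
  length (map (f x) ys) + length (cartesianProductWith f xs ys)
    ≡⟨ cong₂ _+_ (Listₚ.length-map (f x) ys) (length-cartesianProductWith f xs ys) ⟩
  length ys + length xs * length ys                         ∎
  where open ≡-Reasoning

module _ {a} {A : Set a} (options : ℕ → List A) where

  choices : (n : ℕ) → List (Vec A n)
  choices zero    = [] List.∷ List.[]
  choices (suc n) = cartesianProductWith _∷ʳ_ (choices n) (options n)

  ∈-choices⇔ : {xs : Vec A n} → xs ∈ choices n ⇔ (∀ i → lookup xs i ∈ options (toℕ i))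
  ∈-choices⇔ {zero}  {[]} = mk⇔ (λ _ ()) (λ _ → here refl)
  ∈-choices⇔ {suc n} {xs} with ys , y , refl ← initLast xs = mk⇔ sound complete
    where
    sound : ys ∷ʳ y ∈ choices (suc n) → ∀ i → lookup (ys ∷ʳ y) i ∈ options (toℕ i)
    sound mem i with ys′ , y′ , ys′∈ , y′∈ , eq ← ∈ₚ.∈-cartesianProductWith⁻ _∷ʳ_ (choices n) (options n) mem
      with refl , refl ← Vecₚ.∷ʳ-injective ys ys′ eq
      with fromℕ-or-inject₁ i
    ... | inj₁ refl = subst₂ _∈_ (sym (lookup-∷ʳ-fromℕ ys y)) (cong options (sym (Finₚ.toℕ-fromℕ n))) y′∈
    ... | inj₂ (j , refl) = subst₂ _∈_ (sym (lookup-∷ʳ-inject₁ ys y j)) (cong options (sym (Finₚ.toℕ-inject₁ j)))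
                                   (to ∈-choices⇔ ys′∈ j)
    complete : (∀ i → lookup (ys ∷ʳ y) i ∈ options (toℕ i)) → ys ∷ʳ y ∈ choices (suc n)
    complete all = ∈ₚ.∈-cartesianProductWith⁺ _∷ʳ_
      (from ∈-choices⇔ λ j →
        subst₂ _∈_ (lookup-∷ʳ-inject₁ ys y j) (cong options (Finₚ.toℕ-inject₁ j)) (all (inject₁ j)))
      (subst₂ _∈_ (lookup-∷ʳ-fromℕ ys y) (cong options (Finₚ.toℕ-fromℕ n)) (all (fromℕ n)))

  choices-unique : (∀ k → Unique (options k)) → ∀ n → Unique (choices n)
  choices-unique _    zero    = All.[] AllPairs.∷ AllPairs.[]
  choices-unique uniq (suc n) =
    Uniqueₚ.cartesianProductWith⁺ _∷ʳ_ (Vecₚ.∷ʳ-injective _ _) (choices-unique uniq n) (uniq n)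

ThinPair : ℕ → ℕ × ℕ → Set
ThinPair k (x , y) = x ≤ y × y ≤ suc x × y ≤ k

thinPairs : ℕ → List (ℕ × ℕ)
thinPairs k = map (λ x → x , x) (upTo (suc k)) ++ map (λ x → x , suc x) (upTo k)

∈-thinPairs⇔ : ∀ {k x y} → (x , y) ∈ thinPairs k ⇔ ThinPair k (x , y)
∈-thinPairs⇔ {k} {x} {y} = mk⇔ sound complete
  where
  sound : (x , y) ∈ thinPairs k → ThinPair k (x , y)
  sound mem with ∈ₚ.∈-++⁻ (map (λ x → x , x) (upTo (suc k))) mem
  ... | inj₁ mem′ with z , z∈ , refl ← ∈ₚ.∈-map⁻ (λ x → x , x) mem′ =
    ℕₚ.≤-refl , ℕₚ.n≤1+n z , s≤s⁻¹ (∈ₚ.∈-upTo⁻ z∈)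
  ... | inj₂ mem′ with z , z∈ , refl ← ∈ₚ.∈-map⁻ (λ x → x , suc x) mem′ =
    ℕₚ.n≤1+n z , ℕₚ.≤-refl , ∈ₚ.∈-upTo⁻ z∈
  complete : ThinPair k (x , y) → (x , y) ∈ thinPairs k
  complete (x≤y , y≤1+x , y≤k) with ℕₚ.m≤n⇒m<n∨m≡n x≤y
  ... | inj₂ refl = ∈ₚ.∈-++⁺ˡ (∈ₚ.∈-map⁺ (λ x → x , x) (∈ₚ.∈-upTo⁺ (s≤s y≤k)))
  ... | inj₁ x<y with refl ← ℕₚ.≤-antisym x<y y≤1+x =
    ∈ₚ.∈-++⁺ʳ (map (λ x → x , x) (upTo (suc k))) (∈ₚ.∈-map⁺ (λ x → x , suc x) (∈ₚ.∈-upTo⁺ y≤k))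

thinPairs-unique : ∀ k → Unique (thinPairs k)
thinPairs-unique k = Uniqueₚ.++⁺ (Uniqueₚ.map⁺ (cong proj₁) (Uniqueₚ.upTo⁺ (suc k)))
                                 (Uniqueₚ.map⁺ (cong proj₁) (Uniqueₚ.upTo⁺ k)) disjoint
  where
  disjoint : ∀ {p} → p ∈ map (λ x → x , x) (upTo (suc k)) × p ∈ map (λ x → x , suc x) (upTo k) → ⊥
  disjoint (on-diagonal , above-diagonal)
    with z , _ , refl ← ∈ₚ.∈-map⁻ (λ x → x , x) on-diagonal
       | z′ , _ , eq ← ∈ₚ.∈-map⁻ (λ x → x , suc x) above-diagonal =
    ℕₚ.1+n≢n (sym (trans (sym (cong proj₁ eq)) (cong proj₂ eq)))

length-thinPairs : ∀ k → length (thinPairs k) ≡ suc (k + k)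
length-thinPairs k = begin
  length (map (λ x → x , x) (upTo (suc k)) ++ map (λ x → x , suc x) (upTo k))
    ≡⟨ Listₚ.length-++ (map (λ x → x , x) (upTo (suc k))) ⟩
  length (map (λ x → x , x) (upTo (suc k))) + length (map (λ x → x , suc x) (upTo k))
    ≡⟨ cong₂ _+_ (trans (Listₚ.length-map _ (upTo (suc k))) (Listₚ.length-upTo (suc k)))
                 (trans (Listₚ.length-map _ (upTo k)) (Listₚ.length-upTo k)) ⟩
  suc (k + k) ∎
  where open ≡-Reasoning

length-choices-thinPairs : ∀ n → length (choices thinPairs n) ≡ oddFact n
length-choices-thinPairs zero    = refl
length-choices-thinPairs (suc n) = begin
  length (cartesianProductWith _∷ʳ_ (choices thinPairs n) (thinPairs n))
    ≡⟨ length-cartesianProductWith _∷ʳ_ (choices thinPairs n) (thinPairs n) ⟩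
  length (choices thinPairs n) * length (thinPairs n)
    ≡⟨ cong₂ _*_ (length-choices-thinPairs n) (length-thinPairs n) ⟩
  oddFact n * suc (n + n)
    ≡⟨ ℕₚ.*-comm (oddFact n) (suc (n + n)) ⟩
  oddFact (suc n) ∎
  where open ≡-Reasoning

toInterval : Vec (ℕ × ℕ) n → Vec (Fin n) n × Vec (Fin n) n
toInterval zs = fromInvSeq (proj₁ ∘ lookup zs) , fromInvSeq (proj₂ ∘ lookup zs)

intervalCode : Vec (Fin n) n × Vec (Fin n) n → Vec (ℕ × ℕ) n
intervalCode (v , w) = tabulate (λ i → invSeq v i , invSeq w i)

intervalCode∈choices⇔ : (v w : Vec (Fin n) n) →
  intervalCode (v , w) ∈ choices thinPairs n ⇔ (v ≼ w × invSeq w ≤ᶜ suc ∘ invSeq v × IsCode (invSeq w))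
intervalCode∈choices⇔ v w = ⇔.trans (∈-choices⇔ thinPairs) (mk⇔
  (λ all → (λ i → proj₁ (thin i all)) , (λ i → proj₁ (proj₂ (thin i all))) , (λ i → proj₂ (proj₂ (thin i all))))
  (λ (v≼w , thin′ , w-code) i → subst (_∈ thinPairs (toℕ i)) (sym (Vecₚ.lookup∘tabulate _ i))
                                      (from ∈-thinPairs⇔ (v≼w i , thin′ i , w-code i))))
  where
  thin : ∀ i → (∀ j → lookup (intervalCode (v , w)) j ∈ thinPairs (toℕ j)) →
         ThinPair (toℕ i) (invSeq v i , invSeq w i)
  thin i all = to ∈-thinPairs⇔ (subst (_∈ thinPairs (toℕ i)) (Vecₚ.lookup∘tabulate _ i) (all i))

intervalCode-toInterval : {zs : Vec (ℕ × ℕ) n} → zs ∈ choices thinPairs n → intervalCode (toInterval zs) ≡ zs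
intervalCode-toInterval {zs = zs} zs∈ = trans (Vecₚ.tabulate-cong same) (Vecₚ.tabulate∘lookup zs)
  where
  thin : ∀ i → ThinPair (toℕ i) (lookup zs i)
  thin i = to ∈-thinPairs⇔ (to (∈-choices⇔ thinPairs) zs∈ i)
  same : ∀ i → (invSeq (fromInvSeq (proj₁ ∘ lookup zs)) i , invSeq (fromInvSeq (proj₂ ∘ lookup zs)) i)
               ≡ lookup zs i
  same i = cong₂ _,_ (invSeq-fromInvSeq (λ j → ℕₚ.≤-trans (proj₁ (thin j)) (proj₂ (proj₂ (thin j)))) i)
                     (invSeq-fromInvSeq (λ j → proj₂ (proj₂ (thin j))) i)

toInterval-intervalCode : (v w : Vec (Fin n) n) → IsPerm v → IsPerm w →
                          toInterval (intervalCode (v , w)) ≡ (v , w)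
toInterval-intervalCode v w v-perm w-perm = cong₂ _,_
  (fromInvSeq-≗invSeq v v-perm (cong proj₁ ∘ Vecₚ.lookup∘tabulate _))
  (fromInvSeq-≗invSeq w w-perm (cong proj₂ ∘ Vecₚ.lookup∘tabulate _))

toInterval-booleanInterval : {zs : Vec (ℕ × ℕ) n} → zs ∈ choices thinPairs n →
                             BooleanInterval (proj₁ (toInterval zs)) (proj₂ (toInterval zs))
toInterval-booleanInterval {n} {zs} zs∈
  with v≼w , thin , _ ← to (intervalCode∈choices⇔ (proj₁ (toInterval zs)) (proj₂ (toInterval zs)))
                          (subst (_∈ choices thinPairs n) (sym (intervalCode-toInterval zs∈)) zs∈) =
  from (booleanInterval⇔ {v = proj₁ (toInterval zs)} {w = proj₂ (toInterval zs)})
    (fromInvSeq-isPerm (proj₁ ∘ lookup zs) , fromInvSeq-isPerm (proj₂ ∘ lookup zs) , v≼w , thin)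

booleanIntervals : (n : ℕ) → List (Vec (Fin n) n × Vec (Fin n) n)
booleanIntervals n = map toInterval (choices thinPairs n)

∈-booleanIntervals⇔ : (v w : Vec (Fin n) n) → (v , w) ∈ booleanIntervals n ⇔ BooleanInterval v w
∈-booleanIntervals⇔ {n} v w = mk⇔ sound complete
  where
  sound : (v , w) ∈ booleanIntervals n → BooleanInterval v w
  sound mem with zs , zs∈ , eq ← ∈ₚ.∈-map⁻ toInterval mem =
    subst (λ vw → BooleanInterval (proj₁ vw) (proj₂ vw)) (sym eq) (toInterval-booleanInterval zs∈)
  complete : BooleanInterval v w → (v , w) ∈ booleanIntervals n
  complete bi = from-thin (to (booleanInterval⇔ {v = v} {w = w}) bi)
    where
    from-thin : IsPerm v × IsPerm w × v ≼ w × invSeq w ≤ᶜ suc ∘ invSeq v → (v , w) ∈ booleanIntervals n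
    from-thin (v-perm , w-perm , v≼w , thin) =
      subst (_∈ booleanIntervals n) (toInterval-intervalCode v w v-perm w-perm)
        (∈ₚ.∈-map⁺ toInterval (from (intervalCode∈choices⇔ v w) (v≼w , thin , invSeq-isCode w w-perm)))

booleanIntervals-unique : ∀ n → Unique (booleanIntervals n)
booleanIntervals-unique n =
  Uniqueₚ.map⁻ (subst Unique (sym codes-recovered) (choices-unique thinPairs thinPairs-unique n))
  where
  codes-recovered : map intervalCode (booleanIntervals n) ≡ choices thinPairs n
  codes-recovered = trans (sym (Listₚ.map-∘ (choices thinPairs n)))
                          (Listₚ.map-id-local (All.tabulate intervalCode-toInterval))

corollary3p7 : ∀ (n : ℕ) → 1 ≤ n →
    Σ (List (Vec (Fin n) n × Vec (Fin n) n)) λ L →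
      Unique L ×
      (∀ v w → ((v , w) ∈ L) ⇔ BooleanInterval v w) ×
      (length L ≡ oddFact n)
corollary3p7 n _ =
  booleanIntervals n , booleanIntervals-unique n , ∈-booleanIntervals⇔ ,
  trans (Listₚ.length-map toInterval (choices thinPairs n)) (length-choices-thinPairs n)
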